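{- Let $G$ be a graph. (i) If $G$ has at least two universal vertices, then ${\rm mdim}(G)=n(G)$. (ii) If $G$ has exactly one universal vertex, then ${\rm mdim}(G)=n(G)-1$.
   Context: All graphs are finite, simple and connected; $n(G)=|V(G)|$. A universal vertex is a vertex of degree $n(G)-1$. For vertices $u,v$, $d_G(u,v)$ is the shortest-path distance; for an edge $x=ww'$ and a vertex $v$, $d_G(x,v)=\min\{d_G(w,v),d_G(w',v)\}$. A vertex $v$ resolves two elements $x,y\in V(G)\cup E(G)$ if $d_G(x,v)\ne d_G(y,v)$. A set $W\subseteq V(G)$ is a mixed resolving set of $G$ if every two distinct elements of $V(G)\cup E(G)$ are resolved by some vertex of $W$. The mixed metric dimension ${\rm mdim}(G)$ is the minimum cardinality of a mixed resolving set of $G$. -}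

module Defs where

open import Data.Nat using (ℕ; zero; suc; _<_; _≤_; _∸_; _⊓_)
open import Data.Fin using (Fin) renaming (_<_ to _<ᶠ_)
open import Data.Fin.Subset using (Subset; _∈_; ∣_∣)
open import Data.Unit using (⊤)
open import Data.Bool using (Bool; true; false)
open import Data.Vec using (tabulate)
open import Data.Product using (Σ; ∃; ∃-syntax; _×_; _,_)
open import Relation.Binary.PropositionalEquality using (_≡_; _≢_)
open import Relation.Nullary using (¬_)

data Walk {m : ℕ} (adj : Fin m → Fin m → Bool) : Fin m → Fin m → ℕ → Set where
  here : ∀ {u} → Walk adj u u zero
  step : ∀ {u w v k} → adj u w ≡ true → Walk adj w v k → Walk adj u v (suc k)

record Graph : Set where
  field
    n         : ℕ
    adj       : Fin n → Fin n → Bool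
    sym       : ∀ u v → adj u v ≡ adj v u
    irr       : ∀ u → adj u u ≡ false
    connected : ∀ u v → ∃[ k ] Walk adj u v k

open Graph public

order : Graph → ℕ
order G = n G

Dist : (G : Graph) → Fin (n G) → Fin (n G) → ℕ → Set
Dist G u v k = Walk (adj G) u v k × (∀ m → m < k → ¬ Walk (adj G) u v m)

degree : (G : Graph) → Fin (n G) → ℕ
degree G v = ∣ tabulate (adj G v) ∣

Universal : (G : Graph) → Fin (n G) → Set
Universal G v = degree G v ≡ n G ∸ 1

-- raw elements of V(G) ∪ E(G); an edge is written with endpoints u < w
data Raw (m : ℕ) : Set where
  vtx  : Fin m → Raw m
  edge : Fin m → Fin m → Raw m

IsElem : (G : Graph) → Raw (n G) → Set
IsElem G (vtx v) = ⊤
IsElem G (edge u w) = (u <ᶠ w) × (adj G u w ≡ true)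

ElemDist : (G : Graph) → Raw (n G) → Fin (n G) → ℕ → Set
ElemDist G (vtx u) v k = Dist G u v k
ElemDist G (edge u w) v k =
  Σ ℕ λ a → Σ ℕ λ b → Dist G u v a × Dist G w v b × k ≡ a ⊓ b

Resolves : (G : Graph) → Fin (n G) → Raw (n G) → Raw (n G) → Set
Resolves G v x y =
  Σ ℕ λ a → Σ ℕ λ b → ElemDist G x v a × ElemDist G y v b × a ≢ b

MixedResolving : (G : Graph) → Subset (n G) → Set
MixedResolving G W =
  ∀ x y → IsElem G x → IsElem G y → x ≢ y →
    ∃[ v ] (v ∈ W × Resolves G v x y)

IsMdim : (G : Graph) → ℕ → Set
IsMdim G k =
  (∃[ W ] (MixedResolving G W × ∣ W ∣ ≡ k)) ×
  (∀ W → MixedResolving G W → k ≤ ∣ W ∣)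

{-# OPTIONS --safe #-}
-- If u is universal then, for z ≠ v, the vertex u and the edge uv are equally far from z: d(u,z)
-- is at most 1 and d(v,z) at least 1. Hence every mixed resolving set contains V ∖ {u}, and with a
-- second universal vertex w also u. Conversely V ∖ {u} resolves every pair of elements except a
-- vertex a against the edge au. That pair is resolved by u itself, or, when u is the only universal
-- vertex, by a non-neighbour z of a, which is at distance 2 from a but 1 from the edge au.
module Submission where

open import Defs
open import Data.Nat using (ℕ; zero; suc; _+_; _∸_; _⊓_; _≤_; _<_; z≤n; s≤s)
open import Data.Nat.Properties
  using (+-suc; +-identityʳ; m<1+n⇒m<n∨m≡n; <-cmp; <-irrefl; <⇒≢; >⇒≢; ≤-reflexive; ≤-trans;
         m⊓n≤m; m⊓n≤n; m≤n⇒m⊓n≡m; ⊓-comm; ⊓-pres-m<)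
open import Data.Fin using (Fin; _≟_) renaming (_<_ to _<ᶠ_)
open import Data.Fin.Properties using (any?; ¬∀⟶∃¬)
  renaming (<-cmp to <ᶠ-cmp; <-irrefl to <ᶠ-irrefl; <-asym to <ᶠ-asym; <⇒≢ to <ᶠ⇒≢)
open import Data.Fin.Subset using (Subset; _∈_; _⊆_; _⊂_; ∣_∣; ⊤; ⁅_⁆; ∁)
open import Data.Fin.Subset.Properties
  using (∈⊤; ⊆⊤; ∣⊤∣≡n; ∣⁅x⁆∣≡1; ∣∁p∣≡n∸∣p∣; x≢y⇒x∉⁅y⁆; x∉⁅y⁆⇒x≢y; x∉p⇒x∈∁p; x∈∁p⇒x∉p;
         ⊆-antisym; p⊆q⇒∣p∣≤∣q∣; p⊂q⇒∣p∣<∣q∣)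
open import Data.Vec using (tabulate)
open import Data.Vec.Properties using ([]=⇒lookup; lookup⇒[]=; lookup∘tabulate)
open import Data.Bool using (true; false)
import Data.Bool.Properties as Bool
open import Data.Product using (∃-syntax; _×_; _,_)
open import Data.Sum using (_⊎_; inj₁; inj₂)
open import Data.Empty using (⊥-elim)
open import Data.Unit using (tt)
open import Function using (id)
open import Relation.Nullary using (¬_; Dec; yes; no; contradiction)
open import Relation.Nullary.Decidable using (map′; _×-dec_; _→-dec_; ¬?)
open import Relation.Binary using (tri<; tri≈; tri>)
open import Relation.Binary.PropositionalEquality using (_≡_; _≢_; refl; trans; cong; subst; ≢-sym)
import Relation.Binary.PropositionalEquality as ≡

least-witness : {P : ℕ → Set} → (∀ k → Dec (P k)) → ∀ {k} → P k →
  ∃[ m ] (P m × (∀ j → j < m → ¬ P j))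
least-witness {P} P? {k} p = search k 0 (λ _ ()) (subst P (≡.sym (+-identityʳ k)) p)
  where
  search : ∀ d b → (∀ j → j < b → ¬ P j) → P (d + b) → ∃[ m ] (P m × (∀ j → j < m → ¬ P j))
  search d b below pd+b with P? b
  ... | yes pb = b , pb , below
  search zero    b below pb   | no ¬pb = contradiction pb ¬pb
  search (suc d) b below pd+b | no ¬pb =
    search d (suc b) below′ (subst P (≡.sym (+-suc d b)) pd+b)
    where
    below′ : ∀ j → j < suc b → ¬ P j
    below′ j j<1+b with m<1+n⇒m<n∨m≡n j<1+b
    ... | inj₁ j<b  = below j j<b
    ... | inj₂ refl = ¬pb

∣∁⁅x⁆∣≡n∸1 : ∀ {n} (x : Fin n) → ∣ ∁ ⁅ x ⁆ ∣ ≡ n ∸ 1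
∣∁⁅x⁆∣≡n∸1 {n} x = trans (∣∁p∣≡n∸∣p∣ ⁅ x ⁆) (cong (n ∸_) (∣⁅x⁆∣≡1 x))

x≢y⇒x∈∁⁅y⁆ : ∀ {n} {x y : Fin n} → x ≢ y → x ∈ ∁ ⁅ y ⁆
x≢y⇒x∈∁⁅y⁆ x≢y = x∉p⇒x∈∁p (x≢y⇒x∉⁅y⁆ x≢y)

x∈∁⁅y⁆⇒x≢y : ∀ {n} {x y : Fin n} → x ∈ ∁ ⁅ y ⁆ → x ≢ y
x∈∁⁅y⁆⇒x≢y x∈ = x∉⁅y⁆⇒x≢y (x∈∁p⇒x∉p x∈)

sole-candidate-∈ : ∀ {n} {W : Subset n} {v : Fin n} {R : Fin n → Set} →
  ∃[ z ] (z ∈ W × R z) → (∀ {z} → z ≢ v → ¬ R z) → v ∈ W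
sole-candidate-∈ {v = v} (z , z∈W , r) ¬r with z ≟ v
... | yes refl = z∈W
... | no z≢v   = contradiction r (¬r z≢v)

infix 4 _∈ᴿ_ _∉ᴿ_ _∈ᴿ?_

data _∈ᴿ_ {m : ℕ} : Fin m → Raw m → Set where
  vertex : ∀ {a}   → a ∈ᴿ vtx a
  endˡ   : ∀ {a b} → a ∈ᴿ edge a b
  endʳ   : ∀ {a b} → b ∈ᴿ edge a b

_∉ᴿ_ : ∀ {m} → Fin m → Raw m → Set
z ∉ᴿ x = ¬ z ∈ᴿ x

_∈ᴿ?_ : ∀ {m} (z : Fin m) (x : Raw m) → Dec (z ∈ᴿ x)
z ∈ᴿ? vtx a = map′ (λ { refl → vertex }) (λ { vertex → refl }) (z ≟ a)
z ∈ᴿ? edge a b with z ≟ a | z ≟ b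
... | yes refl | _        = yes endˡ
... | no _     | yes refl = yes endʳ
... | no z≢a   | no z≢b   = no λ { endˡ → z≢a refl ; endʳ → z≢b refl }

Separates : ∀ {m} → Fin m → Raw m → Raw m → Set
Separates z x y = (z ∈ᴿ x × z ∉ᴿ y) ⊎ (z ∈ᴿ y × z ∉ᴿ x)

TwoSeparators : ∀ {m} → Raw m → Raw m → Set
TwoSeparators x y = ∃[ z ] ∃[ z′ ] (z ≢ z′ × Separates z x y × Separates z′ x y)

module _ {m : ℕ} where

  vertices-twoSeparators : {a b : Fin m} → a ≢ b → TwoSeparators (vtx a) (vtx b)
  vertices-twoSeparators a≢b =
    _ , _ , a≢b , inj₁ (vertex , λ { vertex → a≢b refl }) , inj₂ (vertex , λ { vertex → a≢b refl })

  vertex-edge-twoSeparators : {a b c : Fin m} → a ∉ᴿ edge b c → TwoSeparators (vtx a) (edge b c)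
  vertex-edge-twoSeparators a∉ =
    _ , _ , (λ { refl → a∉ endˡ }) , inj₁ (vertex , a∉) , inj₂ (endˡ , λ { vertex → a∉ endˡ })

  other-endpoint : {a b c : Fin m} → b ≢ c → a ∈ᴿ edge b c → ∃[ p ] (p ∈ᴿ edge b c × p ≢ a)
  other-endpoint b≢c endˡ = _ , endʳ , ≢-sym b≢c
  other-endpoint b≢c endʳ = _ , endˡ , b≢c

  edge-≡ : {a b c d : Fin m} → a <ᶠ b → c <ᶠ d →
    a ∈ᴿ edge c d → b ∈ᴿ edge c d → edge a b ≡ edge c d
  edge-≡ a<b c<d endˡ endˡ = ⊥-elim (<ᶠ-irrefl refl a<b)
  edge-≡ a<b c<d endˡ endʳ = refl
  edge-≡ a<b c<d endʳ endˡ = ⊥-elim (<ᶠ-asym a<b c<d)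
  edge-≡ a<b c<d endʳ endʳ = ⊥-elim (<ᶠ-irrefl refl a<b)

  endpoint-outside : {a b c d : Fin m} → a <ᶠ b → c <ᶠ d → edge a b ≢ edge c d →
    ∃[ p ] (p ∈ᴿ edge a b × p ∉ᴿ edge c d)
  endpoint-outside {a} {b} {c} {d} a<b c<d e≢e′ with a ∈ᴿ? edge c d | b ∈ᴿ? edge c d
  ... | no a∉  | _      = a , endˡ , a∉
  ... | yes _  | no b∉  = b , endʳ , b∉
  ... | yes a∈ | yes b∈ = contradiction (edge-≡ a<b c<d a∈ b∈) e≢e′

  edges-twoSeparators : {a b c d : Fin m} → a <ᶠ b → c <ᶠ d → edge a b ≢ edge c d →
    TwoSeparators (edge a b) (edge c d)
  edges-twoSeparators a<b c<d e≢e′ with endpoint-outside a<b c<d e≢e′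
                                      | endpoint-outside c<d a<b (≢-sym e≢e′)
  ... | p , p∈ , p∉ | q , q∈ , q∉ =
    p , q , (λ { refl → q∉ p∈ }) , inj₁ (p∈ , p∉) , inj₂ (q∈ , q∉)

module _ (G : Graph) where

  private
    V : Set
    V = Fin (n G)

  Dominating : V → Set
  Dominating u = ∀ z → z ≢ u → adj G u z ≡ true

  neighbours : V → Subset (n G)
  neighbours v = tabulate (adj G v)

  adjacent⇒∈neighbours : {v z : V} → adj G v z ≡ true → z ∈ neighbours v
  adjacent⇒∈neighbours {v} {z} e = lookup⇒[]= z _ (trans (lookup∘tabulate (adj G v) z) e)

  ∈neighbours⇒adjacent : {v z : V} → z ∈ neighbours v → adj G v z ≡ true
  ∈neighbours⇒adjacent {v} {z} z∈ = trans (≡.sym (lookup∘tabulate (adj G v) z)) ([]=⇒lookup z∈)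

  adjacent⇒≢ : {u v : V} → adj G u v ≡ true → u ≢ v
  adjacent⇒≢ {u} e refl with trans (≡.sym e) (irr G u)
  ... | ()

  neighbours⊆∁⁅v⁆ : {v : V} → neighbours v ⊆ ∁ ⁅ v ⁆
  neighbours⊆∁⁅v⁆ z∈ = x≢y⇒x∈∁⁅y⁆ (≢-sym (adjacent⇒≢ (∈neighbours⇒adjacent z∈)))

  dominating⇒universal : {u : V} → Dominating u → Universal G u
  dominating⇒universal {u} dom = trans (cong ∣_∣ neighbours≡∁⁅u⁆) (∣∁⁅x⁆∣≡n∸1 u)
    where
    neighbours≡∁⁅u⁆ : neighbours u ≡ ∁ ⁅ u ⁆
    neighbours≡∁⁅u⁆ = ⊆-antisym neighbours⊆∁⁅v⁆
      (λ z∈ → adjacent⇒∈neighbours (dom _ (x∈∁⁅y⁆⇒x≢y z∈)))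

  universal⇒dominating : {u : V} → Universal G u → Dominating u
  universal⇒dominating {u} univ z z≢u with adj G u z in e
  ... | true  = refl
  ... | false = contradiction (p⊂q⇒∣p∣<∣q∣ neighbours⊂∁⁅u⁆) (<-irrefl equal-sizes)
    where
    neighbours⊂∁⁅u⁆ : neighbours u ⊂ ∁ ⁅ u ⁆
    neighbours⊂∁⁅u⁆ = neighbours⊆∁⁅v⁆ , z , x≢y⇒x∈∁⁅y⁆ z≢u ,
      λ z∈ → contradiction (trans (≡.sym e) (∈neighbours⇒adjacent z∈)) λ ()
    equal-sizes : ∣ neighbours u ∣ ≡ ∣ ∁ ⁅ u ⁆ ∣
    equal-sizes = trans univ (≡.sym (∣∁⁅x⁆∣≡n∸1 u))

  ¬dominating⇒non-neighbour : {a : V} → ¬ Dominating a → ∃[ z ] (z ≢ a × adj G a z ≡ false)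
  ¬dominating⇒non-neighbour {a} ¬dom
    with ¬∀⟶∃¬ (n G) _ (λ z → ¬? (z ≟ a) →-dec (adj G a z Bool.≟ true)) ¬dom
  ... | z , ¬adjacent with z ≟ a
  ...   | yes z≡a = contradiction (λ z≢a → contradiction z≡a z≢a) ¬adjacent
  ...   | no z≢a  = z , z≢a , Bool.¬-not (λ e → ¬adjacent (λ _ → e))

  walk? : ∀ u v k → Dec (Walk (adj G) u v k)
  walk? u v zero    = map′ (λ { refl → here }) (λ { here → refl }) (u ≟ v)
  walk? u v (suc k) =
    map′ (λ (_ , e , p) → step e p) (λ { (step e p) → _ , e , p })
         (any? λ w → (adj G u w Bool.≟ true) ×-dec walk? w v k)

  dist-exists : (u v : V) → ∃[ k ] Dist G u v k
  dist-exists u v with connected G u v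
  ... | _ , w = least-witness (walk? u v) w

  dist-unique : {u v : V} {a b : ℕ} → Dist G u v a → Dist G u v b → a ≡ b
  dist-unique {a = a} {b} (wa , a-least) (wb , b-least) with <-cmp a b
  ... | tri< a<b _ _ = contradiction wa (b-least a a<b)
  ... | tri≈ _ a≡b _ = a≡b
  ... | tri> _ _ b<a = contradiction wb (a-least b b<a)

  dist-refl : {u : V} → Dist G u u 0
  dist-refl = here , λ _ ()

  dist-adjacent : {u v : V} → adj G u v ≡ true → Dist G u v 1
  dist-adjacent e = step e here , λ { zero _ here → adjacent⇒≢ e refl ; (suc _) (s≤s ()) _ }

  dist-two : {u v w : V} → u ≢ v → adj G u v ≡ false →
    adj G u w ≡ true → adj G w v ≡ true → Dist G u v 2
  dist-two u≢v nonadjacent e e′ = step e (step e′ here) , shorter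
    where
    shorter : ∀ j → j < 2 → ¬ Walk (adj G) _ _ j
    shorter zero       _ here           = u≢v refl
    shorter (suc zero) _ (step e″ here) with trans (≡.sym e″) nonadjacent
    ... | ()
    shorter (suc (suc _)) (s≤s (s≤s ())) _

  dist-pos : {u v : V} {k : ℕ} → u ≢ v → Dist G u v k → 0 < k
  dist-pos {k = zero}  u≢v (here , _) = contradiction refl u≢v
  dist-pos {k = suc k} _   _          = s≤s z≤n

  dominating⇒dist≤1 : {u z : V} {k : ℕ} → Dominating u → Dist G u z k → k ≤ 1
  dominating⇒dist≤1 {u} {z} dom d with z ≟ u
  ... | yes refl = subst (_≤ 1) (≡.sym (dist-unique d dist-refl)) z≤n
  ... | no z≢u   = ≤-reflexive (dist-unique d (dist-adjacent (dom z z≢u)))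

  elemDist-exists : (x : Raw (n G)) (v : V) → ∃[ k ] ElemDist G x v k
  elemDist-exists (vtx a)    v = dist-exists a v
  elemDist-exists (edge a b) v with dist-exists a v | dist-exists b v
  ... | k , da | l , db = k ⊓ l , k , l , da , db , refl

  elemDist-zero : {x : Raw (n G)} {v : V} → v ∈ᴿ x → ElemDist G x v 0
  elemDist-zero vertex             = dist-refl
  elemDist-zero {edge _ b} {v} endˡ with dist-exists b v
  ... | l , db = 0 , l , dist-refl , db , refl
  elemDist-zero {edge a _} {v} endʳ with dist-exists a v
  ... | k , da = k , 0 , da , dist-refl , ≡.sym (⊓-comm k 0)

  elemDist-pos : {x : Raw (n G)} {v : V} {k : ℕ} → v ∉ᴿ x → ElemDist G x v k → 0 < k
  elemDist-pos {vtx a} v∉ d = dist-pos (λ { refl → v∉ vertex }) d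
  elemDist-pos {edge a b} v∉ (_ , _ , da , db , refl) =
    ⊓-pres-m< (dist-pos (λ { refl → v∉ endˡ }) da) (dist-pos (λ { refl → v∉ endʳ }) db)

  elemDist-≤ : {x : Raw (n G)} {w v : V} {d k : ℕ} →
    w ∈ᴿ x → Dist G w v d → ElemDist G x v k → k ≤ d
  elemDist-≤ vertex dw dx = ≤-reflexive (dist-unique dx dw)
  elemDist-≤ endˡ dw (k , l , da , _ , refl) =
    ≤-trans (m⊓n≤m k l) (≤-reflexive (dist-unique da dw))
  elemDist-≤ endʳ dw (k , l , _ , db , refl) =
    ≤-trans (m⊓n≤n k l) (≤-reflexive (dist-unique db dw))

  elemDist-flip : {a b v : V} {k : ℕ} → ElemDist G (edge a b) v k → ElemDist G (edge b a) v k
  elemDist-flip (k , l , da , db , refl) = l , k , db , da , ⊓-comm k l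

  resolves-sym : {v : V} {x y : Raw (n G)} → Resolves G v x y → Resolves G v y x
  resolves-sym (k , l , dx , dy , k≢l) = l , k , dy , dx , ≢-sym k≢l

  resolves-flip : {v a b : V} {x : Raw (n G)} →
    Resolves G v x (edge a b) → Resolves G v x (edge b a)
  resolves-flip (k , l , dx , dy , k≢l) = k , l , dx , elemDist-flip dy , k≢l

  separates⇒resolves : {z : V} {x y : Raw (n G)} → Separates z x y → Resolves G z x y
  separates⇒resolves {z} {x} {y} (inj₁ (z∈x , z∉y)) with elemDist-exists y z
  ... | k , dy = 0 , k , elemDist-zero z∈x , dy , <⇒≢ (elemDist-pos z∉y dy)
  separates⇒resolves (inj₂ (z∈y , z∉x)) = resolves-sym (separates⇒resolves (inj₁ (z∈y , z∉x)))

  dominating-unresolved : {u v z : V} → Dominating u → z ≢ v → ¬ Resolves G z (vtx u) (edge u v)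
  dominating-unresolved dom z≢v (k , _ , du , (k′ , l , du′ , dv , refl) , k≢) =
    k≢ (trans (≡.sym k′≡k) (≡.sym (m≤n⇒m⊓n≡m k′≤l)))
    where
    k′≡k : k′ ≡ k
    k′≡k = dist-unique du′ du
    k′≤l : k′ ≤ l
    k′≤l = ≤-trans (dominating⇒dist≤1 dom du′) (dist-pos (≢-sym z≢v) dv)

  dominating-forced : {u v : V} {W : Subset (n G)} →
    Dominating u → MixedResolving G W → v ≢ u → v ∈ W
  dominating-forced {u} {v} {W} dom resolving v≢u with <ᶠ-cmp u v
  ... | tri< u<v _ _ =
    sole-candidate-∈ (resolving (vtx u) (edge u v) tt (u<v , dom v v≢u) λ ())
                     (dominating-unresolved dom)
  ... | tri≈ _ u≡v _ = contradiction (≡.sym u≡v) v≢u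
  ... | tri> _ _ v<u =
    sole-candidate-∈ (resolving (vtx u) (edge v u) tt (v<u , trans (sym G v u) (dom v v≢u)) λ ())
                     (λ z≢v r → dominating-unresolved dom z≢v (resolves-flip {x = vtx u} r))

  -- Distinct elements always have two distinct separating vertices, one of them ≠ u, except a
  -- vertex a against an edge at a, whose only separating vertex is the other endpoint.
  mixedResolving-⊇∁⁅u⁆ : {u : V} {W : Subset (n G)} → ∁ ⁅ u ⁆ ⊆ W →
    (∀ a e → a ≢ u → a ∈ᴿ e → u ∈ᴿ e → ∃[ z ] (z ∈ W × Resolves G z (vtx a) e)) →
    MixedResolving G W
  mixedResolving-⊇∁⁅u⁆ {u} {W} W⊇ pendant = resolving
    where
    pick : {x y : Raw (n G)} → TwoSeparators x y → ∃[ z ] (z ∈ W × Resolves G z x y)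
    pick (z , z′ , z≢z′ , s , s′) with z ≟ u
    ... | yes refl = z′ , W⊇ (x≢y⇒x∈∁⁅y⁆ (≢-sym z≢z′)) , separates⇒resolves s′
    ... | no z≢u   = z , W⊇ (x≢y⇒x∈∁⁅y⁆ z≢u) , separates⇒resolves s

    vertex-edge : ∀ a b c → b <ᶠ c → ∃[ z ] (z ∈ W × Resolves G z (vtx a) (edge b c))
    vertex-edge a b c b<c with a ∈ᴿ? edge b c
    ... | no a∉ = pick (vertex-edge-twoSeparators a∉)
    ... | yes a∈ with other-endpoint (<ᶠ⇒≢ b<c) a∈
    ...   | p , p∈ , p≢a with p ≟ u
    ...     | yes refl = pendant a (edge b c) (≢-sym p≢a) a∈ p∈
    ...     | no p≢u   =
      p , W⊇ (x≢y⇒x∈∁⁅y⁆ p≢u) ,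
      separates⇒resolves {x = vtx a} (inj₂ (p∈ , λ { vertex → p≢a refl }))

    resolving : MixedResolving G W
    resolving (vtx a) (vtx b) _ _ x≢y = pick (vertices-twoSeparators λ { refl → x≢y refl })
    resolving (vtx a) (edge b c) _ (b<c , _) _ = vertex-edge a b c b<c
    resolving (edge b c) (vtx a) (b<c , _) _ _ with vertex-edge a b c b<c
    ... | z , z∈W , r = z , z∈W , resolves-sym {x = vtx a} {y = edge b c} r
    resolving (edge a b) (edge c d) (a<b , _) (c<d , _) e≢e′ =
      pick (edges-twoSeparators a<b c<d e≢e′)

  non-neighbour-≢-dominating : {u a z : V} → Dominating u → a ≢ u → adj G a z ≡ false → z ≢ u
  non-neighbour-≢-dominating {u} {a} dom a≢u nonadjacent refl
    with trans (≡.sym nonadjacent) (trans (sym G a u) (dom a a≢u))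
  ... | ()

  non-neighbour-resolves : {u a z : V} {e : Raw (n G)} → Dominating u → a ≢ u → z ≢ a →
    adj G a z ≡ false → u ∈ᴿ e → Resolves G z (vtx a) e
  non-neighbour-resolves {u} {a} {z} {e} dom a≢u z≢a nonadjacent u∈e with elemDist-exists e z
  ... | k , de = 2 , k , d-az , de , >⇒≢ (s≤s (elemDist-≤ u∈e (dist-adjacent u-z) de))
    where
    u-z : adj G u z ≡ true
    u-z = dom z (non-neighbour-≢-dominating dom a≢u nonadjacent)
    d-az : Dist G a z 2
    d-az = dist-two (≢-sym z≢a) nonadjacent (trans (sym G a u) (dom a a≢u)) u-z

  isMdim-two-dominating : {u w : V} → Dominating u → Dominating w → u ≢ w → IsMdim G (n G)
  isMdim-two-dominating {u} {w} dom-u dom-w u≢w =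
    (⊤ , mixedResolving-⊇∁⁅u⁆ {u = u} ⊆⊤ pendant , ∣⊤∣≡n (n G)) ,
    λ W resolving → subst (_≤ ∣ W ∣) (∣⊤∣≡n (n G))
      (p⊆q⇒∣p∣≤∣q∣ {p = ⊤} (λ {v} _ → forced resolving v))
    where
    pendant : ∀ a e → a ≢ u → a ∈ᴿ e → u ∈ᴿ e → ∃[ z ] (z ∈ ⊤ × Resolves G z (vtx a) e)
    pendant a e a≢u _ u∈e =
      u , ∈⊤ , separates⇒resolves {x = vtx a} (inj₂ (u∈e , λ { vertex → a≢u refl }))
    forced : {W : Subset (n G)} → MixedResolving G W → ∀ v → v ∈ W
    forced resolving v with v ≟ u
    ... | yes refl = dominating-forced dom-w resolving u≢w
    ... | no v≢u   = dominating-forced dom-u resolving v≢u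

  isMdim-one-dominating : {u : V} → Dominating u → (∀ a → a ≢ u → ¬ Dominating a) →
    IsMdim G (n G ∸ 1)
  isMdim-one-dominating {u} dom only-u =
    (∁ ⁅ u ⁆ , mixedResolving-⊇∁⁅u⁆ {u = u} id pendant , ∣∁⁅x⁆∣≡n∸1 u) ,
    λ W resolving → subst (_≤ ∣ W ∣) (∣∁⁅x⁆∣≡n∸1 u)
      (p⊆q⇒∣p∣≤∣q∣ (λ v∈ → dominating-forced dom resolving (x∈∁⁅y⁆⇒x≢y v∈)))
    where
    pendant : ∀ a e → a ≢ u → a ∈ᴿ e → u ∈ᴿ e → ∃[ z ] (z ∈ ∁ ⁅ u ⁆ × Resolves G z (vtx a) e)
    pendant a e a≢u _ u∈e with ¬dominating⇒non-neighbour (only-u a a≢u)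
    ... | z , z≢a , nonadjacent =
      z , x≢y⇒x∈∁⁅y⁆ (non-neighbour-≢-dominating dom a≢u nonadjacent) ,
      non-neighbour-resolves dom a≢u z≢a nonadjacent u∈e

mainTheorem6 : (G : Graph) →
    ((∃[ u ] ∃[ w ] (u ≢ w × Universal G u × Universal G w)) →
    IsMdim G (order G))
    ×
    ((∃[ u ] (Universal G u × (∀ w → Universal G w → w ≡ u))) →
    IsMdim G (order G ∸ 1))
mainTheorem6 G = two-universal , one-universal
  where
  two-universal : (∃[ u ] ∃[ w ] (u ≢ w × Universal G u × Universal G w)) → IsMdim G (order G)
  two-universal (u , w , u≢w , univ-u , univ-w) =
    isMdim-two-dominating G (universal⇒dominating G univ-u) (universal⇒dominating G univ-w) u≢w
  one-universal : (∃[ u ] (Universal G u × (∀ w → Universal G w → w ≡ u))) → IsMdim G (order G ∸ 1)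
  one-universal (u , univ-u , unique) =
    isMdim-one-dominating G (universal⇒dominating G univ-u)
      (λ a a≢u dom-a → a≢u (unique a (dominating⇒universal G dom-a)))
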